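{- For every natural number $m \geq 1$, the graph $S^m_3$ (the cycle $C_3$ with a path of $m$ new vertices attached at each of its three vertices) satisfies $\gamma_b(S^m_3) = m+1$.
   Context: For integers $k \geq 3$ and $n \geq 1$, the $k$-sunlet graph of degree $n$, denoted $S^n_k$, is obtained from the cycle $C_k$ (whose vertices are called base vertices) by attaching to each base vertex $b$ a path of $n$ new vertices $b = u_0, u_1, \dots, u_n$ (edges $u_0u_1, u_1u_2,\dots,u_{n-1}u_n$), distinct for different base vertices; so the farthest vertex $u_n$ of each branch is at distance $n$ from its base vertex. For a finite graph $G$ with shortest-path distance $d$, a dominating broadcast function is a function $f: V(G) \to \{0,1,2,\dots\}$ such that every vertex $u$ of $G$ satisfies $d(u,v) \leq f(v)$ for at least one vertex $v$ with $f(v) \geq 1$. The cost of $f$ is $\sum_{v \in V(G)} f(v)$, and $\gamma_b(G)$ is the minimum cost of a dominating broadcast function of $G$. -}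

module Defs where

open import Data.Nat using (ℕ; zero; suc; _+_; _≤_; _%_)
open import Data.Fin using (Fin; toℕ)
open import Data.Product using (_×_; _,_; Σ)
open import Data.Sum using (_⊎_)
open import Relation.Binary.PropositionalEquality using (_≡_)

record Graph : Set₁ where
  field
    V   : Set
    Adj : V → V → Set

open Graph public

data Walk (G : Graph) : V G → V G → ℕ → Set where
  here : ∀ {u} → Walk G u u 0
  step : ∀ {u w v k} → Adj G u w → Walk G w v k → Walk G u v (suc k)

DistLe : (G : Graph) → V G → V G → ℕ → Set
DistLe G u v r = Σ ℕ λ k → k ≤ r × Walk G u v k

sumFin : ∀ n → (Fin n → ℕ) → ℕ
sumFin zero    f = 0
sumFin (suc n) f = f Fin.zero + sumFin n (λ i → f (Fin.suc i))

CycAdj : ∀ k → Fin k → Fin k → Set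
CycAdj (suc k) b b' =
  (toℕ b' ≡ suc (toℕ b) % suc k) ⊎ (toℕ b ≡ suc (toℕ b') % suc k)

-- The k-sunlet graph of degree n, S^n_k.
-- Vertex (b , i) is the vertex u_i on the branch attached to base vertex b
-- (i = 0 is the base vertex b itself, i = n is the far end).
SunAdj : ∀ k n → (Fin k × Fin (suc n)) → (Fin k × Fin (suc n)) → Set
SunAdj k n (b , i) (b' , i') =
     (toℕ i ≡ 0 × toℕ i' ≡ 0 × CycAdj k b b')
  ⊎ (b ≡ b' × suc (toℕ i) ≡ toℕ i')
  ⊎ (b ≡ b' × toℕ i ≡ suc (toℕ i'))

Sunlet : ℕ → ℕ → Graph
Sunlet k n = record { V = Fin k × Fin (suc n) ; Adj = SunAdj k n }

IsDomBroadcast : ∀ k n → (Fin k × Fin (suc n) → ℕ) → Set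
IsDomBroadcast k n f =
  ∀ u → Σ (Fin k × Fin (suc n)) λ v → 1 ≤ f v × DistLe (Sunlet k n) u v (f v)

cost : ∀ k n → (Fin k × Fin (suc n) → ℕ) → ℕ
cost k n f = sumFin k (λ b → sumFin (suc n) (λ i → f (b , i)))

BroadcastDomNumberIs : ∀ k n → ℕ → Set
BroadcastDomNumberIs k n g =
  (Σ (Fin k × Fin (suc n) → ℕ) λ f → IsDomBroadcast k n f × cost k n f ≡ g)
  × (∀ f → IsDomBroadcast k n f → g ≤ cost k n f)

-- Broadcasting with strength m + 1 from a base vertex dominates S^m_3.
-- Conversely, weight every vertex 1 except one base vertex (weight 0), for a
-- total of 3m + 2. Since distances are |i - j| within a branch and i + 1 + j
-- across branches, a sphere of radius d meets the centre's branch at most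
-- twice and then no other branch, or else at most once and every other branch
-- at most once; so spheres have at most 3 vertices. The radius-1 ball has
-- weight at most 3, hence a ball of radius x ≥ 1 has weight at most 3x, and
-- the balls of a dominating broadcast of cost c give 3m + 2 ≤ 3c.
module Submission where

open import Defs
open import Data.Nat using (ℕ; zero; suc; _+_; _*_; _≤_; _<_; z≤n; s≤s; ∣_-_∣; _≟_; _≤?_)
open import Data.Nat.Properties
open import Data.Nat.Tactic.RingSolver using (solve-∀)
open import Data.Fin using (Fin; zero; suc; toℕ; inject₁)
open import Data.Fin.Patterns using (0F; 1F; 2F)
open import Data.Fin.Properties using (toℕ-inject₁; toℕ≤pred[n]) renaming (_≟_ to _≟ᶠ_)
open import Data.Bool using (Bool; true; false; if_then_else_)
open import Data.Product using (_×_; _,_)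
open import Data.Sum as Sum using (_⊎_; inj₁; inj₂)
open import Function using (_∘_)
open import Level using (Level)
open import Relation.Nullary using (Dec; yes; no; does; ¬_)
open import Relation.Nullary.Decidable using (dec-true; dec-false)
open import Relation.Unary using (Pred; Decidable)
open import Relation.Binary.PropositionalEquality
open import Algebra.Properties.Semiring.Sum +-*-semiring
  using (sum; sum-syntax; sum-cong-≗; sum-replicate-zero; ∑-comm; ∑-distrib-+; *-distribˡ-sum)
open import Algebra.Properties.CommutativeSemigroup +-commutativeSemigroup using (x∙yz≈y∙xz)

private variable
  ℓ : Level
  P Q R : Set ℓ

𝟙 : Dec P → ℕ
𝟙 p? = if does p? then 1 else 0

𝟙≤1 : (p? : Dec P) → 𝟙 p? ≤ 1
𝟙≤1 (yes _) = s≤s z≤n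
𝟙≤1 (no _)  = z≤n

𝟙-yes : (p? : Dec P) → P → 𝟙 p? ≡ 1
𝟙-yes p? p rewrite dec-true p? p = refl

𝟙-no : (p? : Dec P) → ¬ P → 𝟙 p? ≡ 0
𝟙-no p? ¬p rewrite dec-false p? ¬p = refl

𝟙-mono : (p? : Dec P) (q? : Dec Q) → (P → Q) → 𝟙 p? ≤ 𝟙 q?
𝟙-mono (no _)  q? P⇒Q = z≤n
𝟙-mono (yes p) q? P⇒Q = ≤-reflexive (sym (𝟙-yes q? (P⇒Q p)))

𝟙-⊎ : (p? : Dec P) (q? : Dec Q) (r? : Dec R) → (P → Q ⊎ R) → 𝟙 p? ≤ 𝟙 q? + 𝟙 r?
𝟙-⊎ (no _)  q? r? P⇒Q⊎R = z≤n
𝟙-⊎ (yes p) q? r? P⇒Q⊎R with P⇒Q⊎R p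
... | inj₁ q rewrite 𝟙-yes q? q = s≤s z≤n
... | inj₂ r rewrite 𝟙-yes r? r = m≤n+m 1 (𝟙 q?)

𝟙*-≤ : (p? : Dec P) (x : ℕ) → 𝟙 p? * x ≤ x
𝟙*-≤ p? x = ≤-trans (*-monoˡ-≤ x (𝟙≤1 p?)) (≤-reflexive (+-identityʳ x))

*𝟙-≤ : (p? : Dec P) {x : ℕ} → x ≤ 1 → 𝟙 p? * x ≤ 𝟙 p?
*𝟙-≤ p? {x} x≤1 = ≤-trans (*-monoʳ-≤ (𝟙 p?) x≤1) (≤-reflexive (*-identityʳ (𝟙 p?)))

sumFin≡sum : ∀ n (f : Fin n → ℕ) → sumFin n f ≡ sum f
sumFin≡sum zero    f = refl
sumFin≡sum (suc n) f = cong (f zero +_) (sumFin≡sum n (f ∘ suc))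

∑-mono-≤ : ∀ {n} {f g : Fin n → ℕ} → (∀ i → f i ≤ g i) → sum f ≤ sum g
∑-mono-≤ {zero}  f≤g = z≤n
∑-mono-≤ {suc n} f≤g = +-mono-≤ (f≤g zero) (∑-mono-≤ (f≤g ∘ suc))

lookup≤sum : ∀ {n} (f : Fin n → ℕ) i → f i ≤ sum f
lookup≤sum f zero    = m≤m+n (f zero) _
lookup≤sum f (suc i) = ≤-trans (lookup≤sum (f ∘ suc) i) (m≤n+m _ (f zero))

∑-const : ∀ n x → ∑[ _ < n ] x ≡ n * x
∑-const zero    x = refl
∑-const (suc n) x = cong (x +_) (∑-const n x)

∑-zero : ∀ {n} {f : Fin n → ℕ} → (∀ i → f i ≡ 0) → sum f ≡ 0
∑-zero {n} f≡0 = trans (sum-cong-≗ f≡0) (sum-replicate-zero n)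

∑-split-≟ : ∀ {k} (b : Fin (suc k)) (h : Bool → ℕ) →
            ∑[ c < suc k ] h (does (c ≟ᶠ b)) ≡ h true + k * h false
∑-split-≟ {k}     zero    h = cong (h true +_) (∑-const k (h false))
∑-split-≟ {suc k} (suc b) h = begin
  h false + ∑[ c < suc k ] h (does (c ≟ᶠ b)) ≡⟨ cong (h false +_) (∑-split-≟ b h) ⟩
  h false + (h true + k * h false)            ≡⟨ x∙yz≈y∙xz (h false) (h true) (k * h false) ⟩
  h true + (h false + k * h false)            ∎
  where open ≡-Reasoning

count-none : {A : Pred ℕ ℓ} (A? : Decidable A) → (∀ x → ¬ A x) →
             ∀ N → ∑[ j < N ] 𝟙 (A? (toℕ j)) ≡ 0
count-none A? ¬A N = ∑-zero {N} (λ j → 𝟙-no (A? (toℕ j)) (¬A (toℕ j)))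

count-unique : {A : Pred ℕ ℓ} (A? : Decidable A) → (∀ {x y} → A x → A y → x ≡ y) →
               ∀ N → ∑[ j < N ] 𝟙 (A? (toℕ j)) ≤ 1
count-unique A? unique zero    = z≤n
count-unique A? unique (suc N) with A? 0
... | yes a0 = ≤-reflexive (cong suc (count-none (A? ∘ suc) (λ x a → 1+n≢0 (unique a a0)) N))
... | no _   = count-unique (A? ∘ suc) (λ a b → suc-injective (unique a b)) N

module _ {k n : ℕ} where

  sum² : (Fin k × Fin n → ℕ) → ℕ
  sum² f = ∑[ b < k ] ∑[ i < n ] f (b , i)

  sum²-mono-≤ : {f g : Fin k × Fin n → ℕ} → (∀ u → f u ≤ g u) → sum² f ≤ sum² g
  sum²-mono-≤ f≤g = ∑-mono-≤ (λ b → ∑-mono-≤ (λ i → f≤g (b , i)))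

  lookup≤sum² : (f : Fin k × Fin n → ℕ) → ∀ u → f u ≤ sum² f
  lookup≤sum² f (b , i) =
    ≤-trans (lookup≤sum (λ j → f (b , j)) i) (lookup≤sum (λ c → ∑[ j < n ] f (c , j)) b)

  sum²-distrib-+ : (f g : Fin k × Fin n → ℕ) → sum² (λ u → f u + g u) ≡ sum² f + sum² g
  sum²-distrib-+ f g = trans (sum-cong-≗ (λ b → ∑-distrib-+ (λ i → f (b , i)) (λ i → g (b , i))))
                             (∑-distrib-+ (λ b → ∑[ i < n ] f (b , i)) (λ b → ∑[ i < n ] g (b , i)))

  *-distribˡ-sum² : ∀ x (f : Fin k × Fin n → ℕ) → x * sum² f ≡ sum² (λ u → x * f u)
  *-distribˡ-sum² x f = trans (*-distribˡ-sum x (λ b → ∑[ i < n ] f (b , i)))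
                              (sum-cong-≗ (λ b → *-distribˡ-sum x (λ i → f (b , i))))

  sum²-comm : (G : Fin k × Fin n → Fin k × Fin n → ℕ) →
              sum² (λ u → sum² (G u)) ≡ sum² (λ v → sum² (λ u → G u v))
  sum²-comm G = begin
    ∑[ a < k ] ∑[ b < n ] ∑[ c < k ] ∑[ d < n ] G (a , b) (c , d)
      ≡⟨ sum-cong-≗ (λ a → ∑-comm (λ b c → ∑[ d < n ] G (a , b) (c , d))) ⟩
    ∑[ a < k ] ∑[ c < k ] ∑[ b < n ] ∑[ d < n ] G (a , b) (c , d)
      ≡⟨ sum-cong-≗ (λ a → sum-cong-≗ (λ c → ∑-comm (λ b d → G (a , b) (c , d)))) ⟩
    ∑[ a < k ] ∑[ c < k ] ∑[ d < n ] ∑[ b < n ] G (a , b) (c , d)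
      ≡⟨ ∑-comm (λ a c → ∑[ d < n ] ∑[ b < n ] G (a , b) (c , d)) ⟩
    ∑[ c < k ] ∑[ a < k ] ∑[ d < n ] ∑[ b < n ] G (a , b) (c , d)
      ≡⟨ sum-cong-≗ (λ c → ∑-comm (λ a d → ∑[ b < n ] G (a , b) (c , d))) ⟩
    ∑[ c < k ] ∑[ d < n ] ∑[ a < k ] ∑[ b < n ] G (a , b) (c , d) ∎
    where open ≡-Reasoning

cost≡sum² : ∀ {k n} (f : Fin k × Fin (suc n) → ℕ) → cost k n f ≡ sum² f
cost≡sum² {k} {n} f = trans (sumFin≡sum k _) (sum-cong-≗ (λ b → sumFin≡sum (suc n) (λ i → f (b , i))))

-- Distance between heights x and y on the same branch (true) or on two
-- different branches (false). Treating all base vertices as adjacent is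
-- exact for k = 3 and an underestimate for k > 3.
branchDist : Bool → ℕ → ℕ → ℕ
branchDist true  x y = ∣ x - y ∣
branchDist false x y = x + suc y

dist : ∀ {k n} → Fin k × Fin (suc n) → Fin k × Fin (suc n) → ℕ
dist (b , i) (c , j) = branchDist (does (b ≟ᶠ c)) (toℕ i) (toℕ j)

branchDist-triangle : ∀ s x y z → branchDist s x z ≤ ∣ x - y ∣ + branchDist s y z
branchDist-triangle true  x y z = ∣-∣-triangle x y z
branchDist-triangle false x y z = begin
  x + suc z             ≤⟨ +-monoˡ-≤ (suc z) (m≤∣m-n∣+n x y) ⟩
  ∣ x - y ∣ + y + suc z ≡⟨ +-assoc ∣ x - y ∣ y (suc z) ⟩
  ∣ x - y ∣ + (y + suc z) ∎
  where open ≤-Reasoning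

branchDist-base-step : ∀ s s′ y → branchDist s 0 y ≤ suc (branchDist s′ 0 y)
branchDist-base-step s s′ y = ≤-trans (from-base s) (s≤s (to-base s′))
  where
  from-base : ∀ s → branchDist s 0 y ≤ suc y
  from-base true  = n≤1+n y
  from-base false = ≤-refl
  to-base : ∀ s → y ≤ branchDist s 0 y
  to-base true  = ≤-refl
  to-base false = n≤1+n y

branchDist-adjacent : ∀ s {x y} z → ∣ x - y ∣ ≡ 1 → branchDist s x z ≤ suc (branchDist s y z)
branchDist-adjacent s {x} {y} z ∣x-y∣≡1 =
  ≤-trans (branchDist-triangle s x y z) (≤-reflexive (cong (_+ branchDist s y z) ∣x-y∣≡1))

∣n-1+n∣≡1 : ∀ n → ∣ n - suc n ∣ ≡ 1
∣n-1+n∣≡1 zero    = refl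
∣n-1+n∣≡1 (suc n) = ∣n-1+n∣≡1 n

dist-self : ∀ {k n} (u : Fin k × Fin (suc n)) → dist u u ≡ 0
dist-self (b , i) rewrite dec-true (b ≟ᶠ b) refl = ∣n-n∣≡0 (toℕ i)

dist-step : ∀ {k n} {u w : Fin k × Fin (suc n)} v → SunAdj k n u w → dist u v ≤ suc (dist w v)
dist-step {u = b , i} {b′ , i′} (c , j) (inj₁ (i≡0 , i′≡0 , _)) rewrite i≡0 | i′≡0 =
  branchDist-base-step (does (b ≟ᶠ c)) (does (b′ ≟ᶠ c)) (toℕ j)
dist-step {u = b , i} (c , j) (inj₂ (inj₁ (refl , e))) rewrite sym e =
  branchDist-adjacent (does (b ≟ᶠ c)) (toℕ j) (∣n-1+n∣≡1 (toℕ i))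
dist-step {u = b , i} {_ , i′} (c , j) (inj₂ (inj₂ (refl , e))) rewrite e =
  branchDist-adjacent (does (b ≟ᶠ c)) (toℕ j) (trans (∣-∣-comm (suc (toℕ i′)) (toℕ i′)) (∣n-1+n∣≡1 (toℕ i′)))

walk⇒dist≤ : ∀ {k n} {u v} {ℓ} → Walk (Sunlet k n) u v ℓ → dist u v ≤ ℓ
walk⇒dist≤ {u = u} here             = ≤-reflexive (dist-self u)
walk⇒dist≤ {v = v} (step u~w w⇝v) = ≤-trans (dist-step v u~w) (s≤s (walk⇒dist≤ w⇝v))

∣-∣≡-cases : ∀ x i {d} → ∣ x - i ∣ ≡ d → x ≡ i + d ⊎ x + d ≡ i
∣-∣≡-cases zero    i       refl = inj₂ refl
∣-∣≡-cases (suc x) zero    refl = inj₁ refl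
∣-∣≡-cases (suc x) (suc i) refl = Sum.map (cong suc) (cong suc) (∣-∣≡-cases x i refl)

own-shell≤ : ∀ N i d → ∑[ j < N ] 𝟙 (∣ toℕ j - i ∣ ≟ d) ≤
                       ∑[ j < N ] 𝟙 (toℕ j ≟ i + d) + ∑[ j < N ] 𝟙 (toℕ j + d ≟ i)
own-shell≤ N i d = ≤-trans
  (∑-mono-≤ {N} (λ j → 𝟙-⊎ (∣ toℕ j - i ∣ ≟ d) (toℕ j ≟ i + d) (toℕ j + d ≟ i)
                             (∣-∣≡-cases (toℕ j) i)))
  (≤-reflexive (∑-distrib-+ {N} (λ j → 𝟙 (toℕ j ≟ i + d)) (λ j → 𝟙 (toℕ j + d ≟ i))))

count-≡ : ∀ N i d → ∑[ j < N ] 𝟙 (toℕ j ≟ i + d) ≤ 1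
count-≡ N i d = count-unique (_≟ i + d) (λ p q → trans p (sym q)) N

count-+≡ : ∀ N i d → ∑[ j < N ] 𝟙 (toℕ j + d ≟ i) ≤ 1
count-+≡ N i d = count-unique (λ x → x + d ≟ i) (λ p q → +-cancelʳ-≡ d _ _ (trans p (sym q))) N

own-shell≤2 : ∀ N i d → ∑[ j < N ] 𝟙 (∣ toℕ j - i ∣ ≟ d) ≤ 2
own-shell≤2 N i d = ≤-trans (own-shell≤ N i d) (+-mono-≤ (count-≡ N i d) (count-+≡ N i d))

own-shell≤1 : ∀ N i d → i < d → ∑[ j < N ] 𝟙 (∣ toℕ j - i ∣ ≟ d) ≤ 1
own-shell≤1 N i d i<d = ≤-trans (own-shell≤ N i d) (+-mono-≤ (count-≡ N i d) (≤-reflexive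
  (count-none (λ x → x + d ≟ i) (λ x x+d≡i → <⇒≱ i<d (≤-trans (m≤n+m d x) (≤-reflexive x+d≡i))) N)))

own-shell₀≤1 : ∀ N i → ∑[ j < N ] 𝟙 (∣ toℕ j - i ∣ ≟ 0) ≤ 1
own-shell₀≤1 N i = count-unique (λ x → ∣ x - i ∣ ≟ 0)
  (λ p q → trans (∣m-n∣≡0⇒m≡n p) (sym (∣m-n∣≡0⇒m≡n q))) N

other-shell≤1 : ∀ N i d → ∑[ j < N ] 𝟙 (toℕ j + suc i ≟ d) ≤ 1
other-shell≤1 N i d =
  count-unique (λ x → x + suc i ≟ d) (λ p q → +-cancelʳ-≡ (suc i) _ _ (trans p (sym q))) N

other-shell≡0 : ∀ N i d → d ≤ i → ∑[ j < N ] 𝟙 (toℕ j + suc i ≟ d) ≡ 0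
other-shell≡0 N i d d≤i =
  count-none (λ x → x + suc i ≟ d) (λ x e → <⇒≱ (s≤s d≤i) (≤-trans (m≤n+m (suc i) x) (≤-reflexive e))) N

module _ {m : ℕ} where

  Vertex : Set
  Vertex = Fin 3 × Fin (suc m)

  weight : Vertex → ℕ
  weight (_ , suc _)     = 1
  weight (0F , zero)     = 0
  weight (suc _ , zero)  = 1

  weight≤1 : ∀ u → weight u ≤ 1
  weight≤1 (_ , suc _)    = ≤-refl
  weight≤1 (0F , zero)    = z≤n
  weight≤1 (suc _ , zero) = ≤-refl

  sphere : Vertex → ℕ → ℕ
  sphere v d = sum² (λ u → 𝟙 (dist u v ≟ d) * weight u)

  ball : Vertex → ℕ → ℕ
  ball v r = sum² (λ u → 𝟙 (dist u v ≤? r) * weight u)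

  sphere≤own+2*other : ∀ b i d → sphere (b , i) d ≤
    ∑[ j < suc m ] 𝟙 (∣ toℕ j - toℕ i ∣ ≟ d) + 2 * ∑[ j < suc m ] 𝟙 (toℕ j + suc (toℕ i) ≟ d)
  sphere≤own+2*other b i d = ≤-trans
    (sum²-mono-≤ (λ u → *𝟙-≤ (dist u (b , i) ≟ d) (weight≤1 u)))
    (≤-reflexive (∑-split-≟ b (λ s → ∑[ j < suc m ] 𝟙 (branchDist s (toℕ j) (toℕ i) ≟ d))))

  sphere₀≤1 : ∀ v → sphere v 0 ≤ 1
  sphere₀≤1 (b , i) = ≤-trans (sphere≤own+2*other b i 0)
    (+-mono-≤ (own-shell₀≤1 (suc m) (toℕ i))
              (≤-reflexive (cong (2 *_) (other-shell≡0 (suc m) (toℕ i) 0 z≤n))))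

  sphere≤2 : ∀ b i d → d ≤ toℕ i → sphere (b , i) d ≤ 2
  sphere≤2 b i d d≤i = ≤-trans (sphere≤own+2*other b i d)
    (+-mono-≤ (own-shell≤2 (suc m) (toℕ i) d)
              (≤-reflexive (cong (2 *_) (other-shell≡0 (suc m) (toℕ i) d d≤i))))

  sphere≤3 : ∀ v d → sphere v d ≤ 3
  sphere≤3 (b , i) d with d ≤? toℕ i
  ... | yes d≤i = ≤-trans (sphere≤2 b i d d≤i) (n≤1+n 2)
  ... | no  d≰i = ≤-trans (sphere≤own+2*other b i d)
    (+-mono-≤ (own-shell≤1 (suc m) (toℕ i) d (≰⇒> d≰i))
              (*-monoʳ-≤ 2 (other-shell≤1 (suc m) (toℕ i) d)))

  ball₀≤sphere₀ : ∀ v → ball v 0 ≤ sphere v 0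
  ball₀≤sphere₀ v =
    sum²-mono-≤ (λ u → *-monoˡ-≤ (weight u) (𝟙-mono (dist u v ≤? 0) (dist u v ≟ 0) n≤0⇒n≡0))

  ball-suc≤ : ∀ v r → ball v (suc r) ≤ ball v r + sphere v (suc r)
  ball-suc≤ v r = ≤-trans (sum²-mono-≤ split) (≤-reflexive (sum²-distrib-+ inner boundary))
    where
    inner boundary : Vertex → ℕ
    inner    u = 𝟙 (dist u v ≤? r) * weight u
    boundary u = 𝟙 (dist u v ≟ suc r) * weight u
    split : ∀ u → 𝟙 (dist u v ≤? suc r) * weight u ≤ inner u + boundary u
    split u = ≤-trans
      (*-monoˡ-≤ (weight u) (𝟙-⊎ (dist u v ≤? suc r) (dist u v ≤? r) (dist u v ≟ suc r)
                                 (Sum.map₁ ≤-pred ∘ m≤n⇒m<n∨m≡n)))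
      (≤-reflexive (*-distribʳ-+ (weight u) (𝟙 (dist u v ≤? r)) (𝟙 (dist u v ≟ suc r))))

  -- Only here is the zero weight needed: the radius-1 ball around a base
  -- vertex contains four vertices, one of which is (0 , 0).
  ball-base≤3 : ∀ b → ball (b , zero) 1 ≤ 3
  ball-base≤3 b = begin
    ball (b , zero) 1
      ≤⟨ ∑-mono-≤ (λ c → +-mono-≤ (𝟙*-≤ (branchDist (does (c ≟ᶠ b)) 0 0 ≤? 1) (weight (c , zero)))
                                    (≤-reflexive (sum-cong-≗ {m} λ j →
                                      *-identityʳ (𝟙 (branchDist (does (c ≟ᶠ b)) (suc (toℕ j)) 0 ≤? 1))))) ⟩
    ∑[ c < 3 ] (weight (c , zero) + far (does (c ≟ᶠ b)))
      ≡⟨ ∑-distrib-+ (λ c → weight (c , zero)) (λ c → far (does (c ≟ᶠ b))) ⟩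
    2 + ∑[ c < 3 ] far (does (c ≟ᶠ b))
      ≡⟨ cong (2 +_) (∑-split-≟ b far) ⟩
    2 + (far true + 2 * far false)
      ≤⟨ +-monoʳ-≤ 2 (+-mono-≤ far-own≤1 (≤-reflexive (cong (2 *_) far-other≡0))) ⟩
    3 ∎
    where
    open ≤-Reasoning
    far : Bool → ℕ
    far s = ∑[ j < m ] 𝟙 (branchDist s (suc (toℕ j)) 0 ≤? 1)
    far-own≤1 : far true ≤ 1
    far-own≤1 = count-unique (λ x → suc x ≤? 1)
      (λ p q → trans (n≤0⇒n≡0 (≤-pred p)) (sym (n≤0⇒n≡0 (≤-pred q)))) m
    far-other≡0 : far false ≡ 0
    far-other≡0 = count-none (λ x → suc x + 1 ≤? 1) (λ x p → m+1+n≢0 x (n≤0⇒n≡0 (≤-pred p))) m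

  ball₁≤3 : ∀ v → ball v 1 ≤ 3
  ball₁≤3 (b , zero)  = ball-base≤3 b
  ball₁≤3 (b , suc i) = ≤-trans (ball-suc≤ (b , suc i) 0)
    (+-mono-≤ (≤-trans (ball₀≤sphere₀ (b , suc i)) (sphere₀≤1 (b , suc i)))
              (sphere≤2 b (suc i) 1 (s≤s z≤n)))

  ball≤3*radius : ∀ v r → ball v (suc r) ≤ 3 * suc r
  ball≤3*radius v zero    = ball₁≤3 v
  ball≤3*radius v (suc r) = begin
    ball v (suc (suc r))                    ≤⟨ ball-suc≤ v (suc r) ⟩
    ball v (suc r) + sphere v (suc (suc r)) ≤⟨ +-mono-≤ (ball≤3*radius v r) (sphere≤3 v (suc (suc r))) ⟩
    3 * suc r + 3                           ≡⟨ +-comm (3 * suc r) 3 ⟩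
    3 + 3 * suc r                           ≡⟨ *-suc 3 (suc r) ⟨
    3 * suc (suc r)                         ∎
    where open ≤-Reasoning

  coverage : (Vertex → ℕ) → Vertex → Vertex → ℕ
  coverage f v u = 𝟙 (1 ≤? f v) * (𝟙 (dist u v ≤? f v) * weight u)

  weight≤coverage : ∀ {f} → IsDomBroadcast 3 m f → ∀ u → weight u ≤ sum² (λ v → coverage f v u)
  weight≤coverage {f} dom u with dom u
  ... | v , 1≤fv , ℓ , ℓ≤fv , u⇝v =
    ≤-trans (≤-reflexive covered) (lookup≤sum² (λ v → coverage f v u) v)
    where
    covered : weight u ≡ coverage f v u
    covered rewrite 𝟙-yes (1 ≤? f v) 1≤fv
                  | 𝟙-yes (dist u v ≤? f v) (≤-trans (walk⇒dist≤ u⇝v) ℓ≤fv) =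
      sym (trans (*-identityˡ (1 * weight u)) (*-identityˡ (weight u)))

  coverage≤ : ∀ f v → sum² (coverage f v) ≤ 3 * f v
  coverage≤ f v = ≤-trans (≤-reflexive (sym (*-distribˡ-sum² (𝟙 (1 ≤? f v)) within))) (gated (f v))
    where
    within : Vertex → ℕ
    within u = 𝟙 (dist u v ≤? f v) * weight u
    gated : ∀ r → 𝟙 (1 ≤? r) * ball v r ≤ 3 * r
    gated zero    = z≤n
    gated (suc r) = ≤-trans (𝟙*-≤ (1 ≤? suc r) (ball v (suc r))) (ball≤3*radius v r)

  total-weight : sum² weight ≡ 3 * m + 2
  total-weight = begin
    sum² weight                        ≡⟨⟩
    ones + (suc ones + (suc ones + 0)) ≡⟨ cong (λ t → t + (suc t + (suc t + 0))) ones≡m ⟩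
    m + (suc m + (suc m + 0))          ≡⟨ rearrange m ⟩
    3 * m + 2                          ∎
    where
    open ≡-Reasoning
    ones = ∑[ _ < m ] 1
    ones≡m : ones ≡ m
    ones≡m = trans (∑-const m 1) (*-identityʳ m)
    rearrange : ∀ n → n + (suc n + (suc n + 0)) ≡ 3 * n + 2
    rearrange = solve-∀

lower-bound : ∀ m f → IsDomBroadcast 3 m f → m + 1 ≤ cost 3 m f
lower-bound m f dom = 3m+2≤3c⇒m+1≤c (begin
  3 * m + 2                                  ≡⟨ total-weight {m} ⟨
  sum² (weight {m})                          ≤⟨ sum²-mono-≤ (weight≤coverage dom) ⟩
  sum² (λ u → sum² (λ v → coverage f v u))   ≡⟨ sum²-comm (λ u v → coverage f v u) ⟩
  sum² (λ v → sum² (coverage f v))           ≤⟨ sum²-mono-≤ (coverage≤ f) ⟩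
  sum² (λ v → 3 * f v)                       ≡⟨ *-distribˡ-sum² 3 f ⟨
  3 * sum² f                                 ≡⟨ cong (3 *_) (cost≡sum² f) ⟨
  3 * cost 3 m f                             ∎)
  where
  open ≤-Reasoning
  3m+2≤3c⇒m+1≤c : ∀ {c} → 3 * m + 2 ≤ 3 * c → m + 1 ≤ c
  3m+2≤3c⇒m+1≤c {c} 3m+2≤3c = subst (_≤ c) (+-comm 1 m)
    (*-cancelˡ-< 3 m c (<-≤-trans (m<m+n (3 * m) (s≤s z≤n)) 3m+2≤3c))

_++ʷ_ : ∀ {G : Graph} {u w v k l} → Walk G u w k → Walk G w v l → Walk G u v (k + l)
here         ++ʷ w⇝v = w⇝v
step u~x x⇝w ++ʷ w⇝v = step u~x (x⇝w ++ʷ w⇝v)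

descend : ∀ {k n} (b : Fin k) ℓ (i : Fin (suc n)) → toℕ i ≡ ℓ →
          Walk (Sunlet k n) (b , i) (b , zero) ℓ
descend b zero    zero    _  = here
descend b (suc ℓ) (suc i) eq =
  step (inj₂ (inj₂ (refl , cong suc (sym (toℕ-inject₁ i)))))
       (descend b ℓ (inject₁ i) (trans (toℕ-inject₁ i) (suc-injective eq)))

hopLength : Fin 3 → ℕ
hopLength 0F = 0
hopLength 1F = 1
hopLength 2F = 1

hop : ∀ {n} (b : Fin 3) → Walk (Sunlet 3 n) (b , zero) (0F , zero) (hopLength b)
hop 0F = here
hop 1F = step (inj₁ (refl , refl , inj₂ refl)) here
hop 2F = step (inj₁ (refl , refl , inj₁ refl)) here

hopLength≤1 : ∀ b → hopLength b ≤ 1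
hopLength≤1 0F = z≤n
hopLength≤1 1F = ≤-refl
hopLength≤1 2F = ≤-refl

central : ∀ m → Fin 3 × Fin (suc m) → ℕ
central m (0F , zero) = m + 1
central m _           = 0

central-dominates : ∀ m → IsDomBroadcast 3 m (central m)
central-dominates m (b , i) =
  (0F , zero) , m≤n+m 1 m ,
  toℕ i + hopLength b , +-mono-≤ (toℕ≤pred[n] i) (hopLength≤1 b) ,
  descend b (toℕ i) i refl ++ʷ hop b

cost-central : ∀ m → cost 3 m (central m) ≡ m + 1
cost-central m = trans (cong₂ (λ x y → m + 1 + x + (y + (y + 0))) (zeros m) (zeros (suc m)))
                       (trans (+-identityʳ (m + 1 + 0)) (+-identityʳ (m + 1)))
  where
  zeros : ∀ n → sumFin n (λ _ → 0) ≡ 0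
  zeros n = trans (sumFin≡sum n _) (sum-replicate-zero n)

theorem3 : ∀ (m : ℕ) → 1 ≤ m → BroadcastDomNumberIs 3 m (m + 1)
theorem3 m _ = (central m , central-dominates m , cost-central m) , lower-bound m
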